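{- Let $t$ be an $\mathrm{SL}_2$-tiling. If $i<j<k$ and $a$ are integers, then $t_{ja}c_{ik}=t_{ia}c_{jk}+t_{ka}c_{ij}$ and $t_{aj}d_{ik}=t_{ai}d_{jk}+t_{ak}d_{ij}$.
   Context: An $\mathrm{SL}_2$-tiling is a map $t:\mathbb{Z}\times\mathbb{Z}\to\{1,2,3,\dots\}$, $(i,j)\mapsto t_{ij}$, with $t_{ij}t_{i+1,j+1}-t_{i,j+1}t_{i+1,j}=1$ for all $i,j$. For integers $i<j$ define $c_{ij}=t_{ib}t_{j,b+1}-t_{i,b+1}t_{jb}$ and $d_{ij}=t_{bi}t_{b+1,j}-t_{bj}t_{b+1,i}$, where $b$ is any integer; these values do not depend on the choice of $b$. -}

module Defs where

open import Data.Integer using (ℤ; _+_; _-_; _*_; _<_; +_; 1ℤ; 0ℤ)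
open import Relation.Binary.PropositionalEquality using (_≡_)

record SL2Tiling : Set where
  field
    t   : ℤ → ℤ → ℤ
    pos : ∀ i j → 0ℤ < t i j
    det : ∀ i j → t i j * t (i + 1ℤ) (j + 1ℤ) - t i (j + 1ℤ) * t (i + 1ℤ) j ≡ 1ℤ

open SL2Tiling public

-- c_{ij} = t_{ib} t_{j,b+1} - t_{i,b+1} t_{jb}, with the (irrelevant) choice b = 0.
c : SL2Tiling → ℤ → ℤ → ℤ
c T i j = t T i 0ℤ * t T j 1ℤ - t T i 1ℤ * t T j 0ℤ

-- d_{ij} = t_{bi} t_{b+1,j} - t_{bj} t_{b+1,i}, with b = 0.
d : SL2Tiling → ℤ → ℤ → ℤ
d T i j = t T 0ℤ i * t T 1ℤ j - t T 0ℤ j * t T 1ℤ i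

module Submission where

-- Fix rows i, j, k and call a column vector v : ℤ → ℤ (row ↦ entry)
-- "related" if  v_j c_ik = v_i c_jk + v_k c_ij.  Since c is computed from
-- columns 0 and 1, those two columns are related by the Plücker identity for
-- three rows of a 2-column matrix.  For every a, the two unimodular 2×2
-- minors between columns a, a+1, a+2 show that the column t_{·,a} + t_{·,a+2}
-- is proportional to the (nowhere zero) column t_{·,a+1}.  Being related is a
-- linear condition, so it survives proportional rescaling and subtraction;
-- hence it propagates from columns a, a+1 to a+2 and from a+1, a+2 to a,
-- and a two-step induction over ℤ makes every column related.  The identity
-- for d is the same statement for the transposed tiling.

open import Defs
open import Data.Integer using (ℤ; _+_; _*_; _<_)
open import Data.Product using (_×_)
open import Relation.Binary.PropositionalEquality using (_≡_)

open import Data.Nat using (zero; suc)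
import Data.Nat.Properties as ℕ
open import Data.Integer using (+_; -[1+_]; _-_; 0ℤ; 1ℤ; NonZero)
open import Data.Integer.Base using (>-nonZero)
open import Data.Integer.Properties using (*-cancelˡ-≡; *-comm; *-assoc; +-comm; +-identityˡ)
open import Data.Integer.Tactic.RingSolver using (solve-∀)
open import Data.Product using (_,_; proj₁)
open import Relation.Binary.PropositionalEquality
  using (refl; sym; trans; cong; cong₂; subst; module ≡-Reasoning)
open ≡-Reasoning

ℤ-induction : (P : ℤ → Set) → P 0ℤ →
  (∀ z → P z → P (z + 1ℤ)) → (∀ z → P (z + 1ℤ) → P z) → ∀ z → P z
ℤ-induction P p₀ up down (+ zero)       = p₀
ℤ-induction P p₀ up down (+ suc n)      =
  subst P (cong +_ (ℕ.+-comm n 1)) (up (+ n) (ℤ-induction P p₀ up down (+ n)))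
ℤ-induction P p₀ up down -[1+ zero ]    = down -[1+ zero ] p₀
ℤ-induction P p₀ up down -[1+ suc n ]   =
  down -[1+ suc n ] (ℤ-induction P p₀ up down -[1+ n ])

ℤ-induction₂ : (P : ℤ → Set) → P 0ℤ → P 1ℤ →
  (∀ z → P z → P (z + 1ℤ) → P (z + 1ℤ + 1ℤ)) →
  (∀ z → P (z + 1ℤ) → P (z + 1ℤ + 1ℤ) → P z) → ∀ z → P z
ℤ-induction₂ P p₀ p₁ up down z =
  proj₁ (ℤ-induction (λ z → P z × P (z + 1ℤ)) (p₀ , p₁)
           (λ z (p , q) → q , up z p q) (λ z (q , r) → down z q r , q) z)

ratio-trans : ∀ s₁ s₂ s₃ u₁ u₂ u₃ .{{_ : NonZero u₂}} →
  s₁ * u₂ ≡ s₂ * u₁ → s₂ * u₃ ≡ s₃ * u₂ → s₁ * u₃ ≡ s₃ * u₁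
ratio-trans s₁ s₂ s₃ u₁ u₂ u₃ r₁₂ r₂₃ = *-cancelˡ-≡ u₂ _ _ (begin
  u₂ * (s₁ * u₃)   ≡⟨ rearrange s₁ u₂ u₃ ⟩
  (s₁ * u₂) * u₃   ≡⟨ cong (_* u₃) r₁₂ ⟩
  (s₂ * u₁) * u₃   ≡⟨ rearrange′ s₂ u₁ u₃ ⟩
  u₁ * (s₂ * u₃)   ≡⟨ cong (u₁ *_) r₂₃ ⟩
  u₁ * (s₃ * u₂)   ≡⟨ rearrange″ s₃ u₁ u₂ ⟩
  u₂ * (s₃ * u₁)   ∎)
  where
  rearrange : ∀ a b c → b * (a * c) ≡ (a * b) * c
  rearrange = solve-∀
  rearrange′ : ∀ a b c → (a * b) * c ≡ b * (a * c)
  rearrange′ = solve-∀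
  rearrange″ : ∀ a b c → b * (a * c) ≡ c * (a * b)
  rearrange″ = solve-∀

Proportional : (s u : ℤ → ℤ) → Set
Proportional s u = ∀ p q → s p * u q ≡ s q * u p

proportional-from-adjacent : (s u : ℤ → ℤ) → (∀ r → NonZero (u r)) →
  (∀ r → s r * u (r + 1ℤ) ≡ s (r + 1ℤ) * u r) → Proportional s u
proportional-from-adjacent s u u≢0 adjacent p q =
  ratio-trans (s p) (s 0ℤ) (s q) (u p) (u 0ℤ) (u q) {{u≢0 0ℤ}} (sym (from-0 p)) (from-0 q)
  where
  from-0 : ∀ q → s 0ℤ * u q ≡ s q * u 0ℤ
  from-0 = ℤ-induction _ refl
    (λ z h → ratio-trans (s 0ℤ) (s z) (s (z + 1ℤ)) (u 0ℤ) (u z) (u (z + 1ℤ))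
               {{u≢0 z}} h (adjacent z))
    (λ z h → ratio-trans (s 0ℤ) (s (z + 1ℤ)) (s z) (u 0ℤ) (u (z + 1ℤ)) (u z)
               {{u≢0 (z + 1ℤ)}} h (sym (adjacent z)))

module ThreeTermRelation (i j k C₁ C₂ C₃ : ℤ) where

  Related : (ℤ → ℤ) → Set
  Related v = v j * C₁ ≡ v i * C₂ + v k * C₃

  related-cancel : (w x y : ℤ → ℤ) → (∀ r → w r ≡ x r + y r) →
    Related w → Related y → Related x
  related-cancel w x y w≡x+y rel-w rel-y = begin
    x j * C₁
      ≡⟨ difference (x j) (y j) C₁ ⟩
    (x j + y j) * C₁ - y j * C₁
      ≡⟨ cong (λ a → a * C₁ - y j * C₁) (sym (w≡x+y j)) ⟩
    w j * C₁ - y j * C₁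
      ≡⟨ cong₂ _-_ rel-w rel-y ⟩
    (w i * C₂ + w k * C₃) - (y i * C₂ + y k * C₃)
      ≡⟨ cong₂ (λ a b → (a * C₂ + b * C₃) - (y i * C₂ + y k * C₃)) (w≡x+y i) (w≡x+y k) ⟩
    ((x i + y i) * C₂ + (x k + y k) * C₃) - (y i * C₂ + y k * C₃)
      ≡⟨ difference₂ (x i) (x k) (y i) (y k) C₂ C₃ ⟩
    x i * C₂ + x k * C₃ ∎
    where
    difference : ∀ a b c → a * c ≡ (a + b) * c - b * c
    difference = solve-∀
    difference₂ : ∀ a b a′ b′ p q →
      ((a + a′) * p + (b + b′) * q) - (a′ * p + b′ * q) ≡ a * p + b * q
    difference₂ = solve-∀

  related-proportional : (s u : ℤ → ℤ) .{{_ : NonZero (u i)}} →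
    Proportional s u → Related u → Related s
  related-proportional s u s∝u rel-u = *-cancelˡ-≡ (u i) _ _ (begin
    u i * (s j * C₁)                       ≡⟨ swap (u i) (s j) C₁ ⟩
    (s j * u i) * C₁                       ≡⟨ cong (_* C₁) (s∝u j i) ⟩
    (s i * u j) * C₁                       ≡⟨ *-assoc (s i) (u j) C₁ ⟩
    s i * (u j * C₁)                       ≡⟨ cong (s i *_) rel-u ⟩
    s i * (u i * C₂ + u k * C₃)            ≡⟨ expand (s i) (u i) (u k) C₂ C₃ ⟩
    u i * (s i * C₂) + (s i * u k) * C₃    ≡⟨ cong (λ a → u i * (s i * C₂) + a * C₃) (s∝u i k) ⟩
    u i * (s i * C₂) + (s k * u i) * C₃    ≡⟨ collect (u i) (s i) (s k) C₂ C₃ ⟩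
    u i * (s i * C₂ + s k * C₃)            ∎)
    where
    swap : ∀ a b c → a * (b * c) ≡ (b * a) * c
    swap = solve-∀
    expand : ∀ a b c p q → a * (b * p + c * q) ≡ b * (a * p) + (a * c) * q
    expand = solve-∀
    collect : ∀ a b c p q → a * (b * p) + (c * a) * q ≡ a * (b * p + c * q)
    collect = solve-∀

unimodular-rows : ∀ a b c d e f →
  a * e - b * d ≡ 1ℤ → b * f - c * e ≡ 1ℤ → (a + c) * e ≡ (d + f) * b
unimodular-rows a b c d e f minor₁ minor₂ = begin
  (a + c) * e                                          ≡⟨ split a b c d e f ⟩
  ((a * e - b * d) - (b * f - c * e)) + (d + f) * b    ≡⟨ cong₂ (λ x y → (x - y) + (d + f) * b) minor₁ minor₂ ⟩
  (1ℤ - 1ℤ) + (d + f) * b                              ≡⟨ +-identityˡ _ ⟩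
  (d + f) * b                                          ∎
  where
  split : ∀ a b c d e f → (a + c) * e ≡ ((a * e - b * d) - (b * f - c * e)) + (d + f) * b
  split = solve-∀

plücker-first : ∀ aᵢ bᵢ aⱼ bⱼ aₖ bₖ →
  aⱼ * (aᵢ * bₖ - bᵢ * aₖ) ≡ aᵢ * (aⱼ * bₖ - bⱼ * aₖ) + aₖ * (aᵢ * bⱼ - bᵢ * aⱼ)
plücker-first = solve-∀

plücker-second : ∀ aᵢ bᵢ aⱼ bⱼ aₖ bₖ →
  bⱼ * (aᵢ * bₖ - bᵢ * aₖ) ≡ bᵢ * (aⱼ * bₖ - bⱼ * aₖ) + bₖ * (aᵢ * bⱼ - bᵢ * aⱼ)
plücker-second = solve-∀

module Columns (T : SL2Tiling) where

  column : ℤ → ℤ → ℤ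
  column a r = t T r a

  flankSum : ℤ → ℤ → ℤ
  flankSum a r = t T r a + t T r (a + 1ℤ + 1ℤ)

  entry≢0 : ∀ r a → NonZero (t T r a)
  entry≢0 r a = >-nonZero (pos T r a)

  flankSum-proportional : ∀ a → Proportional (flankSum a) (column (a + 1ℤ))
  flankSum-proportional a =
    proportional-from-adjacent (flankSum a) (column (a + 1ℤ)) (λ r → entry≢0 r (a + 1ℤ))
    (λ r → unimodular-rows (t T r a) (t T r (a + 1ℤ)) (t T r (a + 1ℤ + 1ℤ))
             (t T (r + 1ℤ) a) (t T (r + 1ℤ) (a + 1ℤ)) (t T (r + 1ℤ) (a + 1ℤ + 1ℤ))
             (det T r a) (det T r (a + 1ℤ)))

  column-related : ∀ i j k a →
    t T j a * c T i k ≡ t T i a * c T j k + t T k a * c T i j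
  column-related i j k = ℤ-induction₂ (λ a → Related (column a))
    (plücker-first  (t T i 0ℤ) (t T i 1ℤ) (t T j 0ℤ) (t T j 1ℤ) (t T k 0ℤ) (t T k 1ℤ))
    (plücker-second (t T i 0ℤ) (t T i 1ℤ) (t T j 0ℤ) (t T j 1ℤ) (t T k 0ℤ) (t T k 1ℤ))
    (λ a rel₀ rel₁ → related-cancel (flankSum a) (column (a + 1ℤ + 1ℤ)) (column a)
                       (λ r → +-comm (t T r a) _) (flankSum-related a rel₁) rel₀)
    (λ a rel₁ rel₂ → related-cancel (flankSum a) (column a) (column (a + 1ℤ + 1ℤ))
                       (λ r → refl) (flankSum-related a rel₁) rel₂)
    where
    open ThreeTermRelation i j k (c T i k) (c T j k) (c T i j)
    flankSum-related : ∀ a → Related (column (a + 1ℤ)) → Related (flankSum a)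
    flankSum-related a = related-proportional (flankSum a) (column (a + 1ℤ))
                           {{entry≢0 i (a + 1ℤ)}} (flankSum-proportional a)

transpose : SL2Tiling → SL2Tiling
transpose T = record
  { t   = λ i j → t T j i
  ; pos = λ i j → pos T j i
  ; det = λ i j → trans (cong (t T j i * t T (j + 1ℤ) (i + 1ℤ) -_)
                              (*-comm (t T (j + 1ℤ) i) (t T j (i + 1ℤ))))
                        (det T j i)
  }

d≡c-transpose : ∀ T i j → d T i j ≡ c (transpose T) i j
d≡c-transpose T i j = cong (t T 0ℤ i * t T 1ℤ j -_) (*-comm (t T 0ℤ j) (t T 1ℤ i))

row-related : ∀ T i j k a →
  t T a j * d T i k ≡ t T a i * d T j k + t T a k * d T i j
row-related T i j k a
  rewrite d≡c-transpose T i k | d≡c-transpose T j k | d≡c-transpose T i j =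
  Columns.column-related (transpose T) i j k a

-- The identities hold for all i, j, k.
proposition5p5 : (T : SL2Tiling) (i j k a : ℤ) → i < j → j < k →
    (t T j a * c T i k ≡ t T i a * c T j k + t T k a * c T i j) ×
    (t T a j * d T i k ≡ t T a i * d T j k + t T a k * d T i j)
proposition5p5 T i j k a _ _ = Columns.column-related T i j k a , row-related T i j k a
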